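{- Let $\Sigma$ be a finite set, let $a:A\to(\mathbf 1+A)^\Sigma$ and $b:B\to(\mathbf 1+B)^\Sigma$ be $\Sigma$-detectors, $x\in A$ and $y\in B$. If $a^\dagger(x)=b^\dagger(y)$, then $\mathcal C_a(x)=\mathcal C_b(y)$.
   Context: $\Sigma^{\mathbb N}$ is the set of streams over $\Sigma$, $\Sigma^+$ the nonempty finite words, $|u|$ length, $u[0:k]$ the prefix of length $k$, $s[m:]$ the stream $k\mapsto s(k+m)$. $\mathbf 1=\{\Downarrow\}$, $+$ disjoint union. A $\Sigma$-detector is a map $a:A\to(\mathbf 1+A)^\Sigma$. $a^+:A\times\Sigma^+\to\mathbf 1+A$: $a^+(x,n)=a(x)(n)$, and $a^+(x,un)=\Downarrow$ if $a^+(x,u)=\Downarrow$, else $a(a^+(x,u))(n)$. $a^\dagger(x)=\{u\in\Sigma^+\mid a^+(x,u)=\Downarrow\text{ and }a^+(x,u[0:k])\neq\Downarrow\text{ for }0<k<|u|\}$ (this is the unique detector morphism from $a$ to the final detector). $[s]$ is the system with state set $\{s[k:]\mid k\in\mathbb N\}$, output $t\mapsto t(0)$, transition $t\mapsto t[1:]$. For such a system $\sigma=\langle\mathrm{out}_\sigma,\mathrm{tr}_\sigma\rangle$, $\mathrm{Join}(\sigma,a)(q,y)=\Downarrow$ if $a(y)(\mathrm{out}_\sigma q)=\Downarrow$ and $(\mathrm{tr}_\sigma q,a(y)(\mathrm{out}_\sigma q))$ otherwise. For $g:G\to\mathbf 1+G$: $g^{(1)}=g$, $g^{(k+1)}(z)=\Downarrow$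 if $g^{(k)}(z)=\Downarrow$, else $g(g^{(k)}(z))$. $\mathcal C_a(x)=\{s\in\Sigma^{\mathbb N}\mid \mathrm{Join}([s],a)^{(k)}(s,x)\ne\Downarrow\text{ for all }k\ge1\}$. -}

module Defs where

open import Data.Nat using (ℕ; zero; suc; _+_; _≤_; _<_; s≤s)
open import Data.Nat.Properties using (+-suc; +-identityʳ; ≤-pred)
open import Data.Fin using (Fin; inject≤)
open import Data.Vec using (Vec; _∷_; []; init; last; lookup; tabulate)
open import Data.Unit using (⊤; tt)
open import Data.Sum using (_⊎_; inj₁; inj₂)
open import Data.Product using (Σ; _×_; _,_)
open import Relation.Binary.PropositionalEquality using (_≡_; _≢_; trans; sym; cong)

𝟏+_ : Set → Set
𝟏+ A = ⊤ ⊎ A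

⇓ : {A : Set} → 𝟏+ A
⇓ = inj₁ tt

Detector : Set → Set → Set
Detector Σ' A = A → Σ' → 𝟏+ A

Stream : Set → Set
Stream Σ' = ℕ → Σ'

-- nonempty finite words of length suc k are  Vec Σ (suc k)
-- prefix u[0:suc j] of a word of length suc k, for suc j ≤ suc k
prefix : {Σ' : Set} {k : ℕ} (j : ℕ) → suc j ≤ suc k → Vec Σ' (suc k) → Vec Σ' (suc j)
prefix j p u = tabulate (λ i → lookup u (inject≤ i p))

step : {Σ' A : Set} → Detector Σ' A → 𝟏+ A → Σ' → 𝟏+ A
step a (inj₁ _) n = ⇓
step a (inj₂ z) n = a z n

a⁺ : {Σ' A : Set} → Detector Σ' A → A → {k : ℕ} → Vec Σ' (suc k) → 𝟏+ A
a⁺ a x {zero}  (n ∷ []) = a x n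
a⁺ a x {suc k} u        = step a (a⁺ a x (init u)) (last u)

-- a†(x) = { u ∈ Σ⁺ | a⁺(x,u) = ⇓ and a⁺(x,u[0:k]) ≠ ⇓ for 0 < k < |u| }
-- (u has length suc k; the proper prefixes have lengths suc j with suc j < suc k)
a† : {Σ' A : Set} → Detector Σ' A → A → {k : ℕ} → Vec Σ' (suc k) → Set
a† a x {k} u =
  (a⁺ a x u ≡ ⇓) × ((j : ℕ) (p : suc j < suc k) → a⁺ a x (prefix j (≤-pred' p) u) ≢ ⇓)
  where
  ≤-pred' : {m n : ℕ} → suc m < n → suc m ≤ n
  ≤-pred' {m} {suc n} (s≤s q) = s≤s (Data.Nat.Properties.≤-trans (Data.Nat.Properties.n≤1+n m) q)
    where import Data.Nat.Properties

record System (Σ' : Set) : Set₁ where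
  field
    Q   : Set
    out : Q → Σ'
    tr  : Q → Q

shift : {Σ' : Set} → ℕ → Stream Σ' → Stream Σ'
shift m s k = s (k + m)

StreamState : {Σ' : Set} → Stream Σ' → Set
StreamState {Σ'} s = Σ (Stream Σ') λ t → Σ ℕ λ k → (i : ℕ) → t i ≡ shift k s i

⟦_⟧ : {Σ' : Set} → Stream Σ' → System Σ'
⟦ s ⟧ = record
  { Q   = StreamState s
  ; out = λ { (t , _ , _) → t 0 }
  ; tr  = λ { (t , k , p) → shift 1 t , suc k ,
               (λ i → trans (cong t (+-comm i 1)) (trans (p (suc i)) (cong s (sym (+-suc i k))))) }
  }
  where open import Data.Nat.Properties using (+-comm)

start : {Σ' : Set} (s : Stream Σ') → StreamState s
start s = s , 0 , λ i → cong s (sym (+-identityʳ i))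

Join : {Σ' A : Set} (σ : System Σ') → Detector Σ' A →
       System.Q σ × A → 𝟏+ (System.Q σ × A)
Join σ a (q , y) with a y (System.out σ q)
... | inj₁ _ = ⇓
... | inj₂ y' = inj₂ (System.tr σ q , y')

-- g^(k) for k ≥ 1, written iter g k = g^(suc k)
iter : {G : Set} → (G → 𝟏+ G) → ℕ → G → 𝟏+ G
iter g zero    z = g z
iter g (suc k) z with iter g k z
... | inj₁ _ = ⇓
... | inj₂ z' = g z'

𝒞 : {Σ' A : Set} → Detector Σ' A → A → Stream Σ' → Set
𝒞 a x s = (k : ℕ) → 1 ≤ k → iter (Join ⟦ s ⟧ a) (pred k) (start s , x) ≢ ⇓
  where open import Data.Nat using (pred)

module Submission where

-- Fix a detector a, a state x and a stream s, and write s⟨k⟩ for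
-- the word s[0:k+1].  Running Join([s],a) from (s,x) is a step-by-step
-- simulation of feeding s to a: after k+1 steps the join has halted exactly
-- when a⁺(x,s⟨k⟩) = ⇓, and otherwise it sits in the state (s[k+1:], a⁺(x,s⟨k⟩)).
-- Hence s ∈ 𝒞_a(x) iff no prefix s⟨k⟩ is halted on by a.  Halting prefixes
-- are decidable, so if some prefix halts then the least one does, and the
-- least halting prefix is by definition an element of a†(x).  Thus
-- s ∈ 𝒞_a(x) iff no prefix of s lies in a†(x), a condition that depends on
-- a and x only through a†(x); the corollary follows.

open import Defs
open import Data.Nat using (ℕ; zero; suc; _+_; _≤_; _<_; s≤s; z≤n)
open import Data.Nat.Properties using (+-identityʳ; +-assoc; ≤-refl; ≤-pred; <⇒≤; m≤n⇒m<n∨m≡n)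
open import Data.Fin using (Fin; toℕ; inject≤)
open import Data.Fin.Properties using (toℕ-inject≤)
open import Data.Vec using (Vec; _∷_; _∷ʳ_; init; last; tabulate)
open import Data.Vec.Properties using (init-∷ʳ; last-∷ʳ; lookup∘tabulate; tabulate-cong)
open import Data.Unit using (⊤; tt)
open import Data.Empty using (⊥; ⊥-elim)
open import Data.Sum using (_⊎_; inj₁; inj₂)
open import Data.Product using (Σ; _×_; _,_; proj₁)
open import Function.Bundles using (_↔_; _⇔_; mk⇔; Equivalence)
open import Relation.Nullary using (¬_; Dec; yes; no)
open import Relation.Binary.PropositionalEquality using (_≡_; _≢_; refl; sym; trans; cong)

initial : {Σ' : Set} → Stream Σ' → (k : ℕ) → Vec Σ' (suc k)
initial s k = tabulate (λ i → s (toℕ i))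

initial-suc : {Σ' : Set} (s : Stream Σ') (k : ℕ) → initial s (suc k) ≡ initial s k ∷ʳ s (suc k)
initial-suc s zero    = refl
initial-suc s (suc k) = cong (s 0 ∷_) (initial-suc (λ i → s (suc i)) k)

prefix-initial : {Σ' : Set} (s : Stream Σ') (j k : ℕ) (p : suc j ≤ suc k) →
                 prefix j p (initial s k) ≡ initial s j
prefix-initial s j k p = tabulate-cong λ i →
  trans (lookup∘tabulate (λ l → s (toℕ l)) (inject≤ i p)) (cong s (toℕ-inject≤ i p))

a⁺-initial-suc : {Σ' A : Set} (a : Detector Σ' A) (x : A) (s : Stream Σ') (k : ℕ) →
                 a⁺ a x (initial s (suc k)) ≡ step a (a⁺ a x (initial s k)) (s (suc k))
a⁺-initial-suc a x s k = begin
  step a (a⁺ a x (init (initial s (suc k)))) (last (initial s (suc k)))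
    ≡⟨ cong (λ v → step a (a⁺ a x (init v)) (last v)) (initial-suc s k) ⟩
  step a (a⁺ a x (init (initial s k ∷ʳ s (suc k)))) (last (initial s k ∷ʳ s (suc k)))
    ≡⟨ cong (λ v → step a (a⁺ a x v) (last (initial s k ∷ʳ s (suc k)))) (init-∷ʳ (s (suc k)) (initial s k)) ⟩
  step a (a⁺ a x (initial s k)) (last (initial s k ∷ʳ s (suc k)))
    ≡⟨ cong (step a (a⁺ a x (initial s k))) (last-∷ʳ (s (suc k)) (initial s k)) ⟩
  step a (a⁺ a x (initial s k)) (s (suc k)) ∎
  where open Relation.Binary.PropositionalEquality.≡-Reasoning

continue : {G : Set} → (G → 𝟏+ G) → 𝟏+ G → 𝟏+ G
continue g (inj₁ _) = ⇓
continue g (inj₂ z) = g z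

iter-suc : {G : Set} (g : G → 𝟏+ G) (k : ℕ) (z : G) → iter g (suc k) z ≡ continue g (iter g k z)
iter-suc g k z with iter g k z
... | inj₁ _ = refl
... | inj₂ _ = refl

module Simulation {Σ' A : Set} (a : Detector Σ' A) (s : Stream Σ') where
  open System ⟦ s ⟧ using (tr)

  At : ℕ → StreamState s → Set
  At m (t , _) = (i : ℕ) → t i ≡ s (i + m)

  start-At : At 0 (start s)
  start-At i = cong s (sym (+-identityʳ i))

  tr-At : ∀ {m} q → At m q → At (suc m) (tr q)
  tr-At {m} (t , _) at i = trans (at (i + 1)) (cong s (+-assoc i 1 m))

  Agree : ℕ → 𝟏+ (StreamState s × A) → 𝟏+ A → Set
  Agree m (inj₁ _)       (inj₁ _)  = ⊤
  Agree m (inj₂ (q , z)) (inj₂ z') = At m q × z ≡ z'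
  Agree m _              _         = ⊥

  Join-step : ∀ {m} q z → At m q → Agree (suc m) (Join ⟦ s ⟧ a (q , z)) (a z (s m))
  Join-step q@(t , _) z at rewrite sym (at 0) with a z (t 0)
  ... | inj₁ _  = tt
  ... | inj₂ z' = tr-At q at , refl

  Agree-continue : ∀ m u v → Agree m u v → Agree (suc m) (continue (Join ⟦ s ⟧ a) u) (step a v (s m))
  Agree-continue m (inj₁ _)       (inj₁ _) _          = tt
  Agree-continue m (inj₂ (q , z)) (inj₂ z) (at , refl) = Join-step q z at

  Join-tracks-a⁺ : ∀ x k → Agree (suc k) (iter (Join ⟦ s ⟧ a) k (start s , x)) (a⁺ a x (initial s k))
  Join-tracks-a⁺ x zero = Join-step (start s) x start-At
  Join-tracks-a⁺ x (suc k)
    rewrite iter-suc (Join ⟦ s ⟧ a) k (start s , x) | a⁺-initial-suc a x s k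
    = Agree-continue (suc k) _ _ (Join-tracks-a⁺ x k)

  Agree-halts : ∀ {m} u v → Agree m u v → u ≡ ⇓ → v ≡ ⇓
  Agree-halts (inj₁ _) (inj₁ _) _ _ = refl

  Agree-halts⁻¹ : ∀ {m} u v → Agree m u v → v ≡ ⇓ → u ≡ ⇓
  Agree-halts⁻¹ (inj₁ _) (inj₁ _) _ _ = refl

  𝒞⇒never-halts : ∀ x → 𝒞 a x s → (k : ℕ) → a⁺ a x (initial s k) ≢ ⇓
  𝒞⇒never-halts x c k halts =
    c (suc k) (s≤s z≤n) (Agree-halts⁻¹ _ _ (Join-tracks-a⁺ x k) halts)

  never-halts⇒𝒞 : ∀ x → ((k : ℕ) → a⁺ a x (initial s k) ≢ ⇓) → 𝒞 a x s
  never-halts⇒𝒞 x never (suc k) _ halts = never k (Agree-halts _ _ (Join-tracks-a⁺ x k) halts)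

Least : (ℕ → Set) → Set
Least P = Σ ℕ λ j → P j × ((i : ℕ) → i < j → ¬ P i)

search : {P : ℕ → Set} → ((n : ℕ) → Dec (P n)) → (k : ℕ) → Least P ⊎ ((i : ℕ) → i < k → ¬ P i)
search dec zero = inj₂ (λ _ ())
search {P} dec (suc k) with search dec k
... | inj₁ least = inj₁ least
... | inj₂ none with dec k
...   | yes pk = inj₁ (k , pk , none)
...   | no ¬pk = inj₂ below
  where
  below : (i : ℕ) → i < suc k → ¬ P i
  below i (s≤s i≤k) with m≤n⇒m<n∨m≡n i≤k
  ... | inj₁ i<k  = none i i<k
  ... | inj₂ refl = ¬pk

minimise : {P : ℕ → Set} → ((n : ℕ) → Dec (P n)) → (k : ℕ) → P k → Least P
minimise dec k pk with search dec (suc k)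
... | inj₁ least = least
... | inj₂ none  = ⊥-elim (none k ≤-refl pk)

halted? : {A : Set} (v : 𝟏+ A) → Dec (v ≡ ⇓)
halted? (inj₁ _) = yes refl
halted? (inj₂ _) = no λ ()

least-halting-prefix : {Σ' A : Set} (a : Detector Σ' A) (x : A) (s : Stream Σ') (k : ℕ) →
                       a⁺ a x (initial s k) ≡ ⇓ → Σ ℕ λ j → a† a x (initial s j)
least-halting-prefix a x s k halts
  with minimise (λ n → halted? (a⁺ a x (initial s n))) k halts
... | j , halts-j , earlier = j , halts-j , λ i i<j halts-i →
  earlier i (≤-pred i<j) (trans (cong (a⁺ a x) (sym (prefix-initial s i j (<⇒≤ i<j)))) halts-i)

𝒞⇔avoids-a† : {Σ' A : Set} (a : Detector Σ' A) (x : A) (s : Stream Σ') →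
              𝒞 a x s ⇔ ((k : ℕ) → ¬ a† a x (initial s k))
𝒞⇔avoids-a† a x s = mk⇔
  (λ c k u∈a† → 𝒞⇒never-halts x c k (proj₁ u∈a†))
  (λ avoids → never-halts⇒𝒞 x λ k halts → let (j , u∈a†) = least-halting-prefix a x s k halts
                                          in avoids j u∈a†)
  where open Simulation a s

corollary2 : (Σ' : Set) (n : ℕ) → Σ' ↔ Fin n →
    {A B : Set} (a : Detector Σ' A) (b : Detector Σ' B) (x : A) (y : B) →
    ((k : ℕ) (u : Vec Σ' (suc k)) → a† a x u ⇔ a† b y u) →
    (s : Stream Σ') → 𝒞 a x s ⇔ 𝒞 b y s
corollary2 _ _ _ a b x y same-a† s = mk⇔
  (λ c → from (𝒞⇔avoids-a† b y s) λ k u∈b† → to (𝒞⇔avoids-a† a x s) c k (from (same-a† k _) u∈b†))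
  (λ c → from (𝒞⇔avoids-a† a x s) λ k u∈a† → to (𝒞⇔avoids-a† b y s) c k (to (same-a† k _) u∈a†))
  where open Equivalence
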